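{- For every $\varepsilon\in(0,1)$ and $m\in\mathbb{N}$ there exists $M_0$ such that for every $M\ge M_0$ the following holds. Suppose we have nonempty finite sets $\mathcal{P}^{rs}$ for $1\le r<s\le M$ and further sets $\mathcal{P}^{rs}_{t}\subseteq\mathcal{P}^{rs}$ with $|\mathcal{P}^{rs}_{t}|\ge\varepsilon|\mathcal{P}^{rs}|$ for $1\le r<s<t\le M$. Then there is a subset $X\subseteq[M]$ of size $m$ and there are elements $P^{rs}\in\mathcal{P}^{rs}$ for all $r<s$ from $X$ such that $P^{rs}\in\mathcal{P}^{rs}_{t}$ for every $t\in X$ with $t>s$. -}

module Defs where

open import Data.Nat using (ℕ)
open import Data.Integer using (+_)
open import Data.Rational using (ℚ; _/_)

toℚ : ℕ → ℚ
toℚ k = + k / 1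

module Submission where

-- Corollary 4.2 by a greedy construction driven by a density pigeonhole.
--
-- Write ε ≥ 1/D, D the denominator of ε, so every 𝒫^{rs}_t has at least |𝒫^{rs}|/D
-- elements.  We scan the indices upwards, keeping a list A of chosen indices, a sorted
-- list T of candidates (all above A), and for every pair r < s in A a point of 𝒫^{rs}
-- lying in 𝒫^{rs}_t for every later chosen t and for every candidate t.  The next index
-- s is the least candidate; for each r ∈ A in turn, double counting yields a point of
-- 𝒫^{rs} lying in 𝒫^{rs}_t for at least a 1/D fraction of the remaining candidates t,
-- and only those candidates are kept.  Choosing s therefore costs a factor D^{|A|}, so
-- F k a = 1 + D^a · F (k-1) (a+1) candidates suffice to choose k further indices when a
-- are chosen, and M₀ = F m 0 works.

open import Defs
open import Data.Nat using (ℕ; zero; suc; _^_; z≤n; s≤s; NonZero)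
  renaming (_≤_ to _≤ₙ_; _<_ to _<ₙ_; _*_ to _*ₙ_; _+_ to _+ₙ_; _≤?_ to _≤?ₙ_)
import Data.Nat.Properties as ℕ
open import Data.Nat.ListAction using (sum)
open import Algebra.Properties.CommutativeSemigroup ℕ.+-commutativeSemigroup using (x∙yz≈y∙xz)
open import Data.Integer as ℤ using (+_; +[1+_]; -[1+_]; +<+)
import Data.Integer.Properties as ℤ
import Data.Sign as Sign
open import Data.Rational using (ℚ; mkℚ; 0ℚ; 1ℚ; _*_; _≤_; _<_; *<*)
import Data.Rational.Properties as ℚ
import Data.Rational.Unnormalised as ℚᵘ
import Data.Rational.Unnormalised.Properties as ℚᵘ
open import Data.Nat.Coprimality using (Coprime; 1-coprimeTo) renaming (sym to coprime-sym)
open import Data.Fin using (Fin; zero; suc) renaming (_<_ to _<ᶠ_)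
open import Data.Fin.Properties using (<-irrefl; <-asym)
open import Data.Fin.Subset using (Subset; _∈_; _∉_; ∣_∣; ⁅_⁆; _∪_; ⊥; inside; outside)
open import Data.Fin.Subset.Properties
  using (_∈?_; drop-there; ∉⊥; x∈p∪q⁻; x∈⁅y⁆⇒x≡y; ∪-identityˡ; ∣⊥∣≡0; ∣p∣≤n)
open import Data.Vec using (_∷_; tail; _[_]=_)
open _[_]=_ using (here; there)
open import Data.List using (List; []; _∷_; length; map; filter; foldr; allFin)
open import Data.List.Properties using (filter-accept; filter-reject; filter-≐; length-tabulate)
open import Data.List.Membership.Propositional using () renaming (_∈_ to _∈ₗ_)
open import Data.List.Membership.Propositional.Properties using (∈-filter⁻)
open import Data.List.Relation.Binary.Subset.Propositional using (_⊆_)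
open import Data.List.Relation.Unary.Any using (here; there)
open import Data.List.Relation.Unary.All as All using (All; []; _∷_)
import Data.List.Relation.Unary.All.Properties as All
open import Data.List.Relation.Unary.AllPairs using (AllPairs; []; _∷_)
import Data.List.Relation.Unary.AllPairs.Properties as AllPairs
open import Data.List.Relation.Unary.Unique.Propositional using (Unique)
open import Data.Product using (Σ; ∃; _×_; _,_; proj₁; proj₂; map₂)
open import Data.Sum using (inj₁; inj₂)
open import Data.Empty using (⊥-elim)
open import Function using (_∘_; id)
open import Relation.Nullary using (¬_; Dec; yes; no)
open import Relation.Unary using (Decidable)
open import Relation.Binary.PropositionalEquality

toℚ-normal : ∀ k → toℚ k ≡ mkℚ (+ k) 0 (coprime-sym (1-coprimeTo k))
toℚ-normal k = ℚ.normalize-coprime (coprime-sym (1-coprimeTo k))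

clearDenominators : ∀ a d .(c : Coprime (suc a) (suc d)) n k →
  mkℚ +[1+ a ] d c * toℚ n ≤ toℚ k → suc a *ₙ n ≤ₙ suc d *ₙ k
clearDenominators a d c n k εn≤k rewrite toℚ-normal n | toℚ-normal k
  with ℚᵘ.≤-respˡ-≃ (ℚ.toℚᵘ-homo-* (mkℚ +[1+ a ] d c) (mkℚ (+ n) 0 (coprime-sym (1-coprimeTo n))))
                    (ℚ.toℚᵘ-mono-≤ εn≤k)
... | ℚᵘ.*≤* cross = ℤ.drop‿+≤+ (subst₂ ℤ._≤_ lhs rhs cross)
  where
  lhs : (Sign.+ ℤ.◃ (suc a *ₙ n)) ℤ.* + 1 ≡ + (suc a *ₙ n)
  lhs = trans (ℤ.*-identityʳ _) (ℤ.+◃n≡+n _)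
  rhs : + k ℤ.* + suc (d *ₙ 1) ≡ + (suc d *ₙ k)
  rhs = trans (sym (ℤ.pos-* k _))
              (cong +_ (trans (cong (λ e → k *ₙ suc e) (ℕ.*-identityʳ d)) (ℕ.*-comm k (suc d))))

-- A positive rational is at least 1/(1+d) for its denominator 1+d, so a density
-- bound ε·n ≤ k becomes the integral bound n ≤ (1+d)·k.
densityBound : (ε : ℚ) → 0ℚ < ε → ∃ λ d → ∀ n k → ε * toℚ n ≤ toℚ k → n ≤ₙ suc d *ₙ k
densityBound (mkℚ +[1+ a ] d c) _ =
  d , λ n k εn≤k → ℕ.≤-trans (ℕ.m≤n*m n (suc a)) (clearDenominators a d c n k εn≤k)
densityBound (mkℚ (+ 0) d c) (*<* (+<+ ()))
densityBound (mkℚ -[1+ a ] d c) (*<* ())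

module Pigeonhole {T : Set} where

  count : ∀ {n} → (T → Subset n) → Fin n → List T → ℕ
  count f j U = length (filter (λ t → j ∈? f t) U)

  weight : ∀ {n} → (T → Subset n) → List T → ℕ
  weight f U = sum (map (λ t → ∣ f t ∣) U)

  ∣p∣-inside : ∀ {n} (p : Subset (suc n)) → zero ∈ p → ∣ p ∣ ≡ suc ∣ tail p ∣
  ∣p∣-inside (inside ∷ q) _ = refl

  ∣p∣-outside : ∀ {n} (p : Subset (suc n)) → zero ∉ p → ∣ p ∣ ≡ ∣ tail p ∣
  ∣p∣-outside (inside ∷ q) 0∉p = ⊥-elim (0∉p here)
  ∣p∣-outside (outside ∷ q) _ = refl

  weight-split : ∀ {n} (f : T → Subset (suc n)) (U : List T) →
    weight f U ≡ count f zero U +ₙ weight (tail ∘ f) U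
  weight-split f [] = refl
  weight-split f (t ∷ U) = splitHead (zero ∈? f t)
    where
    open ≡-Reasoning
    c w : ℕ
    c = count f zero U
    w = weight (tail ∘ f) (t ∷ U)
    splitHead : Dec (zero ∈ f t) → weight f (t ∷ U) ≡ count f zero (t ∷ U) +ₙ w
    splitHead (yes 0∈ft) = begin
      ∣ f t ∣ +ₙ weight f U
        ≡⟨ cong₂ _+ₙ_ (∣p∣-inside (f t) 0∈ft) (weight-split f U) ⟩
      suc (∣ tail (f t) ∣ +ₙ (c +ₙ weight (tail ∘ f) U))
        ≡⟨ cong suc (x∙yz≈y∙xz ∣ tail (f t) ∣ c (weight (tail ∘ f) U)) ⟩
      suc c +ₙ w
        ≡⟨ cong (λ V → length V +ₙ w) (filter-accept (λ t → zero ∈? f t) 0∈ft) ⟨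
      count f zero (t ∷ U) +ₙ w ∎
    splitHead (no 0∉ft) = begin
      ∣ f t ∣ +ₙ weight f U
        ≡⟨ cong₂ _+ₙ_ (∣p∣-outside (f t) 0∉ft) (weight-split f U) ⟩
      ∣ tail (f t) ∣ +ₙ (c +ₙ weight (tail ∘ f) U)
        ≡⟨ x∙yz≈y∙xz ∣ tail (f t) ∣ c (weight (tail ∘ f) U) ⟩
      c +ₙ w
        ≡⟨ cong (λ V → length V +ₙ w) (filter-reject (λ t → zero ∈? f t) 0∉ft) ⟨
      count f zero (t ∷ U) +ₙ w ∎

  count-suc : ∀ {n} (f : T → Subset (suc n)) j (U : List T) →
    count f (suc j) U ≡ count (tail ∘ f) j U
  count-suc f j U = cong length (filter-≐ (λ t → suc j ∈? f t) (λ t → j ∈? tail (f t))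
                                          ((λ {t} → toTail (f t)) , (λ {t} → fromTail (f t))) U)
    where
    toTail : (p : Subset (suc _)) → suc j ∈ p → j ∈ tail p
    toTail (_ ∷ q) = drop-there
    fromTail : (p : Subset (suc _)) → j ∈ tail p → suc j ∈ p
    fromTail (_ ∷ q) = there

  weight-empty : (f : T → Subset 0) (U : List T) → weight f U ≡ 0
  weight-empty f [] = refl
  weight-empty f (t ∷ U) = cong₂ _+ₙ_ (ℕ.n≤0⇒n≡0 (∣p∣≤n (f t))) (weight-empty f U)

  pigeonhole : ∀ D n (f : T → Subset (suc n)) (U : List T) →
    length U *ₙ suc n ≤ₙ D *ₙ weight f U → ∃ λ j → length U ≤ₙ D *ₙ count f j U
  pigeonhole D zero f U heavy = zero , (begin
    length U            ≡⟨ ℕ.*-identityʳ (length U) ⟨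
    length U *ₙ 1       ≤⟨ heavy ⟩
    D *ₙ weight f U     ≡⟨ cong (D *ₙ_) onlyPoint ⟩
    D *ₙ count f zero U ∎)
    where
    open ℕ.≤-Reasoning
    onlyPoint : weight f U ≡ count f zero U
    onlyPoint = trans (weight-split f U)
                      (trans (cong (count f zero U +ₙ_) (weight-empty (tail ∘ f) U)) (ℕ.+-identityʳ _))
  pigeonhole D (suc n) f U heavy with length U ≤?ₙ D *ₙ count f zero U
  ... | yes popular = zero , popular
  ... | no unpopular with pigeonhole D n (tail ∘ f) U (ℕ.+-cancelˡ-≤ (length U) _ _ heavy′)
    where
    open ℕ.≤-Reasoning
    -- the point 0 covers fewer than |U|/D items, so the rest must carry the weight
    heavy′ : length U +ₙ length U *ₙ suc n ≤ₙ length U +ₙ D *ₙ weight (tail ∘ f) U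
    heavy′ = begin
      length U +ₙ length U *ₙ suc n                   ≡⟨ ℕ.*-suc (length U) (suc n) ⟨
      length U *ₙ suc (suc n)                         ≤⟨ heavy ⟩
      D *ₙ weight f U                                 ≡⟨ cong (D *ₙ_) (weight-split f U) ⟩
      D *ₙ (count f zero U +ₙ weight (tail ∘ f) U)    ≡⟨ ℕ.*-distribˡ-+ D _ _ ⟩
      D *ₙ count f zero U +ₙ D *ₙ weight (tail ∘ f) U ≤⟨ ℕ.+-monoˡ-≤ _ (ℕ.<⇒≤ (ℕ.≰⇒> unpopular)) ⟩
      length U +ₙ D *ₙ weight (tail ∘ f) U            ∎
  ... | j , popular = suc j , subst (λ c → length U ≤ₙ D *ₙ c) (sym (count-suc f j U)) popular

  popularPoint : ∀ D n → 0 <ₙ n → (f : T → Subset n) (U : List T) →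
    All (λ t → n ≤ₙ D *ₙ ∣ f t ∣) U → ∃ λ j → length U ≤ₙ D *ₙ count f j U
  popularPoint D (suc n) _ f U dense = pigeonhole D n f U (heavy dense)
    where
    heavy : ∀ {U} → All (λ t → suc n ≤ₙ D *ₙ ∣ f t ∣) U → length U *ₙ suc n ≤ₙ D *ₙ weight f U
    heavy [] = z≤n
    heavy {t ∷ U} (dense-t ∷ dense-U) =
      ℕ.≤-trans (ℕ.+-mono-≤ dense-t (heavy dense-U))
                (ℕ.≤-reflexive (sym (ℕ.*-distribˡ-+ D ∣ f t ∣ (weight f U))))

open Pigeonhole using (count; popularPoint)

fromList : ∀ {n} → List (Fin n) → Subset n
fromList = foldr (λ x p → ⁅ x ⁆ ∪ p) ⊥

∈-fromList⁻ : ∀ {n} {y : Fin n} (xs : List (Fin n)) → y ∈ fromList xs → y ∈ₗ xs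
∈-fromList⁻ [] y∈⊥ = ⊥-elim (∉⊥ y∈⊥)
∈-fromList⁻ (x ∷ xs) y∈ with x∈p∪q⁻ ⁅ x ⁆ (fromList xs) y∈
... | inj₁ y∈⁅x⁆ = here (x∈⁅y⁆⇒x≡y x y∈⁅x⁆)
... | inj₂ y∈xs = there (∈-fromList⁻ xs y∈xs)

∣⁅x⁆∪p∣ : ∀ {n} (x : Fin n) (p : Subset n) → x ∉ p → ∣ ⁅ x ⁆ ∪ p ∣ ≡ suc ∣ p ∣
∣⁅x⁆∪p∣ zero    (inside ∷ q)  x∉p = ⊥-elim (x∉p here)
∣⁅x⁆∪p∣ zero    (outside ∷ q) _   = cong (suc ∘ ∣_∣) (∪-identityˡ q)
∣⁅x⁆∪p∣ (suc x) (inside ∷ q)  x∉p = cong suc (∣⁅x⁆∪p∣ x q (x∉p ∘ there))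
∣⁅x⁆∪p∣ (suc x) (outside ∷ q) x∉p = ∣⁅x⁆∪p∣ x q (x∉p ∘ there)

∣fromList∣ : ∀ {n} (xs : List (Fin n)) → Unique xs → ∣ fromList xs ∣ ≡ length xs
∣fromList∣ {n} [] _ = ∣⊥∣≡0 n
∣fromList∣ (x ∷ xs) (x∉xs ∷ unique) =
  trans (∣⁅x⁆∪p∣ x (fromList xs) (λ x∈ → All.lookup x∉xs (∈-fromList⁻ xs x∈) refl))
        (cong suc (∣fromList∣ xs unique))

-- The number of candidates needed to choose k more indices when a are already
-- chosen, if each refinement keeps a 1/D fraction of the candidates per chosen index.
F : ℕ → ℕ → ℕ → ℕ
F D zero    a = 0
F D (suc k) a = suc (D ^ a *ₙ F D k (suc a))

module Greedy (M : ℕ) (size : Fin M → Fin M → ℕ) (size>0 : ∀ r s → r <ᶠ s → 0 <ₙ size r s)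
              (𝒫 : (r s t : Fin M) → Subset (size r s))
              (D : ℕ) .{{_ : NonZero D}}
              (dense : ∀ r s t → r <ᶠ s → s <ᶠ t → size r s ≤ₙ D *ₙ ∣ 𝒫 r s t ∣) where

  -- Candidate lists are kept strictly increasing, so their head is their least index.
  Sorted : List (Fin M) → Set
  Sorted = AllPairs _<ᶠ_

  Witnessed : List (Fin M) → Set
  Witnessed X = ∀ {r s} → r ∈ₗ X → s ∈ₗ X → r <ᶠ s → Σ (Fin (size r s)) λ p →
    ∀ {t} → t ∈ₗ X → s <ᶠ t → p ∈ 𝒫 r s t

  PairsFixed : List (Fin M) → List (Fin M) → Set
  PairsFixed A T = ∀ {r s} → r ∈ₗ A → s ∈ₗ A → r <ᶠ s → Σ (Fin (size r s)) λ p →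
    (∀ {t} → t ∈ₗ A → s <ᶠ t → p ∈ 𝒫 r s t) × (∀ {t} → t ∈ₗ T → p ∈ 𝒫 r s t)

  record Refinement (s : Fin M) (A U : List (Fin M)) : Set where
    field
      kept   : List (Fin M)
      kept⊆U : kept ⊆ U
      sorted : Sorted kept
      large  : length U ≤ₙ D ^ length A *ₙ length kept
      point  : ∀ {r} → r ∈ₗ A → Σ (Fin (size r s)) λ p → ∀ {t} → t ∈ₗ kept → p ∈ 𝒫 r s t

  -- The refinement step: for r ∈ A in turn, the pigeonhole lemma gives a point of
  -- 𝒫^{rs} in 𝒫^{rs}_t for a 1/D fraction of the candidates t, which are kept.
  refine : (s : Fin M) (A : List (Fin M)) → All (_<ᶠ s) A →
           (U : List (Fin M)) → All (s <ᶠ_) U → Sorted U → Refinement s A U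
  refine s [] _ U _ sortedU = record
    { kept = U ; kept⊆U = id ; sorted = sortedU
    ; large = ℕ.≤-reflexive (sym (ℕ.+-identityʳ (length U))) ; point = λ () }
  refine s (r ∷ A) (r<s ∷ A<s) U s<U sortedU = record
    { kept   = Rest.kept
    ; kept⊆U = proj₁ ∘ keptFilter
    ; sorted = Rest.sorted
    ; large  = large
    ; point  = λ { (here refl) → p , proj₂ ∘ keptFilter ; (there r′∈A) → Rest.point r′∈A } }
    where
    popular : ∃ λ p → length U ≤ₙ D *ₙ count (𝒫 r s) p U
    popular = popularPoint D (size r s) (size>0 r s r<s) (𝒫 r s) U (All.map (dense r s _ r<s) s<U)
    p : Fin (size r s)
    p = proj₁ popular
    inP? : Decidable (λ t → p ∈ 𝒫 r s t)
    inP? t = p ∈? 𝒫 r s t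
    module Rest = Refinement
      (refine s A A<s (filter inP? U) (All.filter⁺ inP? s<U) (AllPairs.filter⁺ inP? sortedU))
    keptFilter : ∀ {t} → t ∈ₗ Rest.kept → t ∈ₗ U × p ∈ 𝒫 r s t
    keptFilter t∈ = ∈-filter⁻ inP? {xs = U} (Rest.kept⊆U t∈)
    large : length U ≤ₙ D ^ length (r ∷ A) *ₙ length Rest.kept
    large = begin
      length U                               ≤⟨ proj₂ popular ⟩
      D *ₙ count (𝒫 r s) p U                 ≤⟨ ℕ.*-monoʳ-≤ D Rest.large ⟩
      D *ₙ (D ^ length A *ₙ length Rest.kept) ≡⟨ ℕ.*-assoc D (D ^ length A) (length Rest.kept) ⟨
      D ^ length (r ∷ A) *ₙ length Rest.kept  ∎
      where open ℕ.≤-Reasoning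

  noneAbove : ∀ {s t A} → All (_<ᶠ s) A → t ∈ₗ s ∷ A → ¬ (s <ᶠ t)
  noneAbove _ (here refl) s<s = <-irrefl refl s<s
  noneAbove A<s (there t∈A) s<t = <-asym {n = M} s<t (All.lookup A<s t∈A)

  -- Choosing the least candidate s and refining the remaining candidates to U
  -- preserves the invariant: old pairs keep their points (s was a candidate), new
  -- pairs (r, s) get the points of the refinement, and no chosen index follows s.
  choose : ∀ {s A T U} → All (_<ᶠ s) A → U ⊆ T →
           (∀ {r} → r ∈ₗ A → Σ (Fin (size r s)) λ p → ∀ {t} → t ∈ₗ U → p ∈ 𝒫 r s t) →
           PairsFixed A (s ∷ T) → PairsFixed (s ∷ A) U
  choose {s} A<s U⊆T new old (here refl) s′∈ s<s′ = ⊥-elim (noneAbove {s} A<s s′∈ s<s′)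
  choose {s} A<s U⊆T new old (there r∈A) (here refl) r<s =
    proj₁ (new r∈A) , (λ t∈ s<t → ⊥-elim (noneAbove {s} A<s t∈ s<t)) , proj₂ (new r∈A)
  choose {s} {A} A<s U⊆T new old {r} {s′} (there r∈A) (there s′∈A) r<s′
    with p , later , candidate ← old r∈A s′∈A r<s′ =
    p , later′ , λ t∈U → candidate (there (U⊆T t∈U))
    where
    later′ : ∀ {t} → t ∈ₗ s ∷ A → s′ <ᶠ t → p ∈ 𝒫 r s′ t
    later′ (here refl) _ = candidate (here refl)
    later′ (there t∈A) s′<t = later t∈A s′<t

  record Homogeneous (n : ℕ) : Set where
    field
      chosen    : List (Fin M)
      length≡   : length chosen ≡ n
      unique    : Unique chosen
      witnessed : Witnessed chosen

  extend : ∀ k (A T : List (Fin M)) → Unique A → (∀ {a t} → a ∈ₗ A → t ∈ₗ T → a <ᶠ t) →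
           Sorted T → PairsFixed A T → F D k (length A) ≤ₙ length T → Homogeneous (k +ₙ length A)
  extend zero A T uniqueA _ _ fixed _ = record
    { chosen = A ; length≡ = refl ; unique = uniqueA
    ; witnessed = λ r∈ s∈ r<s → map₂ proj₁ (fixed r∈ s∈ r<s) }
  extend (suc k) A (s ∷ T) uniqueA below (s<T ∷ sortedT) fixed (s≤s enough) =
    subst Homogeneous (ℕ.+-suc k (length A))
      (extend k (s ∷ A) kept unique′ below′ sorted (choose A<s kept⊆U point fixed) enough′)
    where
    A<s : All (_<ᶠ s) A
    A<s = All.tabulate (λ a∈A → below a∈A (here refl))
    open Refinement (refine s A A<s T s<T sortedT)
    unique′ : Unique (s ∷ A)
    unique′ = All.map (λ a<s s≡a → <-irrefl (sym s≡a) a<s) A<s ∷ uniqueA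
    below′ : ∀ {a t} → a ∈ₗ s ∷ A → t ∈ₗ kept → a <ᶠ t
    below′ (here refl) t∈ = All.lookup s<T (kept⊆U t∈)
    below′ (there a∈A) t∈ = below a∈A (there (kept⊆U t∈))
    enough′ : F D k (suc (length A)) ≤ₙ length kept
    enough′ = ℕ.*-cancelˡ-≤ (D ^ length A) {{ℕ.m^n≢0 D (length A)}} (ℕ.≤-trans enough large)

  select : ∀ m → F D m 0 ≤ₙ M → Homogeneous m
  select m enough = subst Homogeneous (ℕ.+-identityʳ m)
    (extend m [] (allFin M) [] (λ ()) (AllPairs.tabulate⁺-< id) (λ ())
            (subst (F D m 0 ≤ₙ_) (sym (length-tabulate id)) enough))

  Conclusion : ℕ → Set
  Conclusion n = Σ (Subset M) λ X → (∣ X ∣ ≡ n) ×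
    Σ ((r s : Fin M) → r ∈ X → s ∈ X → r <ᶠ s → Fin (size r s)) λ P →
      ∀ r s t (r∈X : r ∈ X) (s∈X : s ∈ X) → t ∈ X → (r<s : r <ᶠ s) → s <ᶠ t →
        P r s r∈X s∈X r<s ∈ 𝒫 r s t

  homogeneousSubset : ∀ {n} → Homogeneous n → Conclusion n
  homogeneousSubset H = fromList chosen , trans (∣fromList∣ chosen unique) length≡ , P , P∈𝒫
    where
    open Homogeneous H
    ∈X : ∀ {x} → x ∈ fromList chosen → x ∈ₗ chosen
    ∈X = ∈-fromList⁻ chosen
    P : (r s : Fin M) → r ∈ fromList chosen → s ∈ fromList chosen → r <ᶠ s → Fin (size r s)
    P r s r∈X s∈X r<s = proj₁ (witnessed (∈X r∈X) (∈X s∈X) r<s)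
    P∈𝒫 : ∀ r s t (r∈X : r ∈ fromList chosen) (s∈X : s ∈ fromList chosen) → t ∈ fromList chosen →
          (r<s : r <ᶠ s) → s <ᶠ t → P r s r∈X s∈X r<s ∈ 𝒫 r s t
    P∈𝒫 r s t r∈X s∈X t∈X r<s s<t =
      proj₂ (witnessed (∈X r∈X) (∈X s∈X) r<s) (∈X t∈X) s<t

corollary4p2 : (ε : ℚ) → 0ℚ < ε → ε < 1ℚ → (m : ℕ) →
    ∃ λ (M₀ : ℕ) → (M : ℕ) → M₀ ≤ₙ M →
    (size : Fin M → Fin M → ℕ) →
    (∀ r s → r <ᶠ s → 0 <ₙ size r s) →
    (𝒫 : (r s t : Fin M) → Subset (size r s)) →
    (∀ r s t → r <ᶠ s → s <ᶠ t → ε * toℚ (size r s) ≤ toℚ ∣ 𝒫 r s t ∣) →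
    Σ (Subset M) λ X → (∣ X ∣ ≡ m) ×
      Σ ((r s : Fin M) → r ∈ X → s ∈ X → r <ᶠ s → Fin (size r s)) λ P →
        ∀ r s t (r∈X : r ∈ X) (s∈X : s ∈ X) → t ∈ X → (r<s : r <ᶠ s) → s <ᶠ t →
          P r s r∈X s∈X r<s ∈ 𝒫 r s t
corollary4p2 ε ε>0 _ m with d , bound ← densityBound ε ε>0 =
  F (suc d) m 0 , λ M M₀≤M size size>0 𝒫 ε-dense →
    let dense = λ r s t r<s s<t → bound (size r s) ∣ 𝒫 r s t ∣ (ε-dense r s t r<s s<t)
        open Greedy M size size>0 𝒫 (suc d) dense
    in homogeneousSubset (select m M₀≤M)
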